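{- The $\mathcal{L}_1$-theory of all Došen frames (the set of sequents $A\vdash B$ of $\mathcal{L}_1$-formulas valid in every Došen frame) is decidable.
   Context: A Došen frame is $\langle S,R\rangle$ with $S$ non-empty and $R\subseteq S^3$; a model adds $V$ mapping propositional variables to subsets of $S$. $\mathcal{L}_1$-formulas: variables, $\top,\bot$, binary $\backslash,\bullet,/,\backslash\!\!\backslash,/\!\!/,\land,\lor$. Satisfaction: $s\vDash p$ iff $s\in V(p)$; $\top$ everywhere, $\bot$ nowhere; $\land,\lor$ classical; $s\vDash A\bullet B$ iff there are $t,u$ with $Rtus$, $t\vDash A$, $u\vDash B$; $s\vDash A\backslash B$ iff for all $t,u$, $Rtsu$ and $t\vDash A$ imply $u\vDash B$; $s\vDash B/A$ iff for all $t,u$, $Rstu$ and $t\vDash A$ imply $u\vDash B$; $s\vDash A\backslash\!\!\backslash B$ iff for all $t$ and all paths $\bar{x}=\langle x_1,\ldots,x_n\rangle$ ($n\ge1$) with every $x_i\vDash A$ and $R\overleftarrow{x}st$, $t\vDash B$; $s\vDash B/\!\!/A$ iff for all $t$ and such paths with $Rs\overrightarrow{x}t$, $t\vDash B$. Here $R\overleftarrow{x}st$: exist $y_1,\ldots,y_{n-1}$ with $Rx_1sy_1$, $Rx_{i+1}y_iy_{i+1}$ ($1\le i\le n-2$), $Rx_ny_{n-1}t$ (for $n=1$: $Rx_1st$); $Rs\overrightarrow{x}t$: exist $y_1,\ldots,y_{n-1}$ with $Rsx_1y_1$, $Ry_ix_{i+1}y_{i+1}$, $Ry_{n-1}x_nt$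 (for $n=1$: $Rsx_1t$). $A\vdash B$ is valid in a frame iff in every model on it every state satisfying $A$ satisfies $B$. -}

module Defs where

open import Data.Nat using (ℕ)
open import Data.List using (List; []; _∷_)
open import Data.List.Relation.Unary.All using (All)
open import Data.Product using (Σ; _×_; _,_)
open import Data.Sum using (_⊎_)
open import Data.Unit using (⊤)
open import Data.Empty using (⊥)

Var : Set
Var = ℕ

infixr 5 _∖_ _∖∖_
infixl 5 _／_ _／／_
infixr 6 _∙_
infixr 4 _∧_
infixr 3 _∨_

data Fm : Set where
  var  : Var → Fm
  ⊤ᶠ ⊥ᶠ : Fm
  _∖_ _∙_ _／_ _∖∖_ _／／_ _∧_ _∨_ : Fm → Fm → Fm

record Frame : Set₁ where
  field
    S   : Set
    inh : S
    R   : S → S → S → Set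

record Model : Set₁ where
  field
    frame : Frame
  open Frame frame public
  field
    V : Var → S → Set

module _ (M : Model) where
  open Model M

  -- Paths are non-empty lists ⟨x₁,…,xₙ⟩ written as head x₁ and tail.
  -- RBack x₁ [x₂,…,xₙ] s t  is  R x⃖ s t :
  --   R x₁ s y₁, R x₂ y₁ y₂, …, R xₙ yₙ₋₁ t   (n = 1: R x₁ s t)
  RBack : S → List S → S → S → Set
  RBack x []        s t = R x s t
  RBack x (x′ ∷ xs) s t = Σ S λ y → R x s y × RBack x′ xs y t

  -- RFwd x₁ [x₂,…,xₙ] s t  is  R s x⃗ t :
  --   R s x₁ y₁, R y₁ x₂ y₂, …, R yₙ₋₁ xₙ t   (n = 1: R s x₁ t)
  RFwd : S → List S → S → S → Set
  RFwd x []        s t = R s x t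
  RFwd x (x′ ∷ xs) s t = Σ S λ y → R s x y × RFwd x′ xs y t

  Sat : Fm → S → Set
  Sat (var p)   s = V p s
  Sat ⊤ᶠ        s = ⊤
  Sat ⊥ᶠ        s = ⊥
  Sat (A ∧ B)   s = Sat A s × Sat B s
  Sat (A ∨ B)   s = Sat A s ⊎ Sat B s
  Sat (A ∙ B)   s = Σ S λ t → Σ S λ u → R t u s × Sat A t × Sat B u
  Sat (A ∖ B)   s = ∀ t u → R t s u → Sat A t → Sat B u
  Sat (B ／ A)  s = ∀ t u → R s t u → Sat A t → Sat B u
  Sat (A ∖∖ B)  s = ∀ t x xs → All (Sat A) (x ∷ xs) → RBack x xs s t → Sat B t
  Sat (B ／／ A) s = ∀ t x xs → All (Sat A) (x ∷ xs) → RFwd x xs s t → Sat B t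

ValidInModel : Model → Fm → Fm → Set
ValidInModel M A B = ∀ s → Sat M A s → Sat M B s

ValidInFrame : Frame → Fm → Fm → Set₁
ValidInFrame F A B = (V : Var → Frame.S F → Set) →
  ValidInModel (record { frame = F ; V = V }) A B

Valid : Fm → Fm → Set₁
Valid A B = (F : Frame) → ValidInFrame F A B

module Submission where

-- Fix a list cl of formulas closed under immediate subformulas (for A ⊢ B: the
-- subformulas of A ∧ B). A type is a subset of cl. Starting from all types we
-- repeatedly discard the types that make a demand (a witness for a failing
-- residual, a factorisation of a product, an escaping path for a failing iterated
-- residual, local consistency for ∧, ∨, ⊤, ⊥) that the remaining types cannot
-- meet; this is an inflationary iteration on a finite set and so stabilises.
--   * Soundness: a discarded type is realised by no state of any model. Since
--     satisfaction is not decidable, "z realises some type" is used in the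
--     constructive form of the cut lemma below.
--   * Completeness: the surviving types, related by the canonical compatibility
--     relation, form a Došen model satisfying the truth lemma.
-- Hence A ⊢ B is valid iff every surviving type containing A contains B, which is
-- a finite check.

open import Defs
open import Data.Bool using (Bool; true; false; T)
open import Data.Bool.Properties using (T-≡)
open import Data.Unit using (⊤; tt)
open import Data.Empty using (⊥-elim)
open import Data.Nat using (ℕ; zero; suc; _≤_; z≤n; s≤s)
import Data.Nat as ℕ
open import Data.Nat.Properties using (≤-trans; <-irrefl)
open import Data.Fin using (Fin)
open import Data.Fin.Properties using (any?)
open import Data.Fin.Subset using (Subset; _∈_; _∉_; _⊆_; _⊂_; _∪_; ∁; ∣_∣) renaming (⊥ to ∅)
open import Data.Fin.Subset.Properties
  using (_∈?_; _⊂?_; ⊆-antisym; p⊂q⇒∣p∣<∣q∣; ∣p∣≤n; p⊆p∪q; x∈p∪q⁺; x∈p∪q⁻; x∈∁p⇒x∉p; x∉p⇒x∈∁p; ∉⊥)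
open import Data.Vec using (tabulate; []; _∷_)
open import Data.Vec.Properties using ([]=⇒lookup; lookup⇒[]=; lookup∘tabulate)
open import Data.List using (List; []; _∷_; _++_; length; map; lookup)
open import Data.List.Membership.Propositional using (find) renaming (_∈_ to _∈ˡ_)
open import Data.List.Membership.Propositional.Properties using (∈-++⁺ˡ; ∈-++⁺ʳ; ∈-++⁻; ∈-map⁺)
open import Data.List.Relation.Unary.All using (All; all?; []; _∷_)
import Data.List.Relation.Unary.All as All
open import Data.List.Relation.Unary.All.Properties using (¬All⇒Any¬)
open import Data.List.Relation.Unary.Any using (here; there)
open import Data.List.Relation.Unary.Any.Properties using (lookup-index)
open import Data.Product using (Σ; _×_; _,_; proj₁; proj₂)
import Data.Product as Product
open import Data.Sum using (_⊎_; inj₁; inj₂; [_,_]′; assocˡ)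
import Data.Sum as Sum
open import Function using (_∘_; id; const; case_of_; Equivalence; _⇔_; mk⇔)
open import Relation.Nullary using (Dec; yes; no; ¬_)
open import Relation.Nullary.Decidable
  using (⌊_⌋; T?; decidable-stable; toWitness; fromWitness; map′; _×-dec_; _⊎-dec_; _→-dec_; ¬?)
open import Relation.Unary using (Decidable)
open import Relation.Binary.Definitions using (DecidableEquality)
open import Relation.Binary.PropositionalEquality
  using (_≡_; refl; sym; trans; cong; cong₂; subst; module ≡-Reasoning)

select : ∀ {n} {P : Fin n → Set} → Decidable P → Subset n
select P? = tabulate (⌊_⌋ ∘ P?)

select-sound : ∀ {n} {P : Fin n → Set} (P? : Decidable P) {x} → x ∈ select P? → P x
select-sound P? {x} x∈ =
  toWitness {a? = P? x} (Equivalence.from T-≡ (trans (sym (lookup∘tabulate _ x)) ([]=⇒lookup x∈)))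

select-complete : ∀ {n} {P : Fin n → Set} (P? : Decidable P) {x} → P x → x ∈ select P?
select-complete P? {x} px =
  lookup⇒[]= x _ (trans (lookup∘tabulate _ x) (Equivalence.to T-≡ (fromWitness {a? = P? x} px)))

⊆-⊄⇒≡ : ∀ {n} {p q : Subset n} → p ⊆ q → ¬ p ⊂ q → p ≡ q
⊆-⊄⇒≡ {p = p} p⊆q p⊄q =
  ⊆-antisym p⊆q (λ {x} x∈q → decidable-stable (x ∈? p) (λ x∉p → p⊄q (p⊆q , x , x∈q , x∉p)))

module Saturation {N : ℕ} (step : Subset N → Subset N) (inflationary : ∀ p → p ⊆ step p) where

  stage : ℕ → Subset N
  stage zero    = ∅
  stage (suc j) = step (stage j)

  limit : Subset N
  limit = stage (suc N)

  -- Until the iteration is stable, every step adds an element.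
  growth : ∀ j → step (stage j) ≡ stage j ⊎ j ≤ ∣ stage j ∣
  growth zero = inj₂ z≤n
  growth (suc j) with growth j
  ... | inj₁ stable = inj₁ (cong step stable)
  ... | inj₂ j≤∣sⱼ∣ with stage j ⊂? step (stage j)
  ...   | yes grows = inj₂ (≤-trans (s≤s j≤∣sⱼ∣) (p⊂q⇒∣p∣<∣q∣ grows))
  ...   | no stuck  = inj₁ (cong step (sym (⊆-⊄⇒≡ (inflationary (stage j)) stuck)))

  limit-fixed : step limit ≡ limit
  limit-fixed with growth (suc N)
  ... | inj₁ stable = stable
  ... | inj₂ N<∣limit∣ = ⊥-elim (<-irrefl refl (≤-trans N<∣limit∣ (∣p∣≤n limit)))

refute→ : ∀ {P Q : Set} → Dec P → ¬ (P → Q) → P × ¬ Q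
refute→ (yes p) f = p , λ q → f (λ _ → q)
refute→ (no ¬p) f = ⊥-elim (f (λ p → ⊥-elim (¬p p)))

-- Formulas are coded injectively as labelled binary trees, whose equality is
-- decided structurally; this gives decidable equality of formulas.
data Code : Set where
  leaf : ℕ → ℕ → Code
  node : ℕ → Code → Code → Code

_≟ᶜ_ : DecidableEquality Code
leaf a p   ≟ᶜ leaf b q   =
  map′ (λ { (refl , refl) → refl }) (λ { refl → refl , refl }) ((a ℕ.≟ b) ×-dec (p ℕ.≟ q))
node a l r ≟ᶜ node b u v =
  map′ (λ { (refl , refl , refl) → refl }) (λ { refl → refl , refl , refl })
       ((a ℕ.≟ b) ×-dec (l ≟ᶜ u) ×-dec (r ≟ᶜ v))
leaf _ _   ≟ᶜ node _ _ _ = no λ ()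
node _ _ _ ≟ᶜ leaf _ _   = no λ ()

encode : Fm → Code
encode (var p)  = leaf 0 p
encode ⊤ᶠ       = leaf 1 0
encode ⊥ᶠ       = leaf 2 0
encode (a ∖ b)  = node 0 (encode a) (encode b)
encode (a ∙ b)  = node 1 (encode a) (encode b)
encode (a ／ b)  = node 2 (encode a) (encode b)
encode (a ∖∖ b) = node 3 (encode a) (encode b)
encode (a ／／ b) = node 4 (encode a) (encode b)
encode (a ∧ b)  = node 5 (encode a) (encode b)
encode (a ∨ b)  = node 6 (encode a) (encode b)

decode : Code → Fm
decode (leaf 0 p)   = var p
decode (leaf 1 _)   = ⊤ᶠ
decode (leaf _ _)   = ⊥ᶠ
decode (node 0 a b) = decode a ∖ decode b
decode (node 1 a b) = decode a ∙ decode b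
decode (node 2 a b) = decode a ／ decode b
decode (node 3 a b) = decode a ∖∖ decode b
decode (node 4 a b) = decode a ／／ decode b
decode (node 5 a b) = decode a ∧ decode b
decode (node _ a b) = decode a ∨ decode b

decode-encode : ∀ φ → decode (encode φ) ≡ φ
decode-encode (var p)  = refl
decode-encode ⊤ᶠ       = refl
decode-encode ⊥ᶠ       = refl
decode-encode (a ∖ b)  = cong₂ _∖_ (decode-encode a) (decode-encode b)
decode-encode (a ∙ b)  = cong₂ _∙_ (decode-encode a) (decode-encode b)
decode-encode (a ／ b)  = cong₂ _／_ (decode-encode a) (decode-encode b)
decode-encode (a ∖∖ b) = cong₂ _∖∖_ (decode-encode a) (decode-encode b)
decode-encode (a ／／ b) = cong₂ _／／_ (decode-encode a) (decode-encode b)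
decode-encode (a ∧ b)  = cong₂ _∧_ (decode-encode a) (decode-encode b)
decode-encode (a ∨ b)  = cong₂ _∨_ (decode-encode a) (decode-encode b)

encode-injective : ∀ {φ ψ} → encode φ ≡ encode ψ → φ ≡ ψ
encode-injective {φ} {ψ} eq = begin
  φ                 ≡⟨ sym (decode-encode φ) ⟩
  decode (encode φ) ≡⟨ cong decode eq ⟩
  decode (encode ψ) ≡⟨ decode-encode ψ ⟩
  ψ                 ∎
  where open ≡-Reasoning

_≟_ : DecidableEquality Fm
φ ≟ ψ = map′ encode-injective (cong encode) (encode φ ≟ᶜ encode ψ)

kids : Fm → List Fm
kids (a ∖ b)  = a ∷ b ∷ []
kids (a ∙ b)  = a ∷ b ∷ []
kids (a ／ b)  = a ∷ b ∷ []
kids (a ∖∖ b) = a ∷ b ∷ []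
kids (a ／／ b) = a ∷ b ∷ []
kids (a ∧ b)  = a ∷ b ∷ []
kids (a ∨ b)  = a ∷ b ∷ []
kids _        = []

Closed : List Fm → Set
Closed cl = ∀ {φ} → φ ∈ˡ cl → ∀ {χ} → χ ∈ˡ kids φ → χ ∈ˡ cl

sub below : Fm → List Fm
sub φ = φ ∷ below φ

below (a ∖ b)  = sub a ++ sub b
below (a ∙ b)  = sub a ++ sub b
below (a ／ b)  = sub a ++ sub b
below (a ∖∖ b) = sub a ++ sub b
below (a ／／ b) = sub a ++ sub b
below (a ∧ b)  = sub a ++ sub b
below (a ∨ b)  = sub a ++ sub b
below _        = []

args⊆ : ∀ a b {χ} → χ ∈ˡ a ∷ b ∷ [] → χ ∈ˡ sub a ++ sub b
args⊆ a b (here refl)         = here refl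
args⊆ a b (there (here refl)) = ∈-++⁺ʳ (sub a) (here refl)

kids⊆below : ∀ φ {χ} → χ ∈ˡ kids φ → χ ∈ˡ below φ
kids⊆below (var _)  ()
kids⊆below ⊤ᶠ       ()
kids⊆below ⊥ᶠ       ()
kids⊆below (a ∖ b)  = args⊆ a b
kids⊆below (a ∙ b)  = args⊆ a b
kids⊆below (a ／ b)  = args⊆ a b
kids⊆below (a ∖∖ b) = args⊆ a b
kids⊆below (a ／／ b) = args⊆ a b
kids⊆below (a ∧ b)  = args⊆ a b
kids⊆below (a ∨ b)  = args⊆ a b

++-closed : ∀ xs {ys} → Closed xs → Closed ys → Closed (xs ++ ys)
++-closed xs cx cy p q with ∈-++⁻ xs p
... | inj₁ px = ∈-++⁺ˡ (cx px q)
... | inj₂ py = ∈-++⁺ʳ xs (cy py q)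

mutual
  sub-closed : ∀ ψ → Closed (sub ψ)
  sub-closed ψ (here refl) q = there (kids⊆below ψ q)
  sub-closed ψ (there p)   q = there (below-closed ψ p q)

  below-closed : ∀ ψ → Closed (below ψ)
  below-closed (a ∖ b)  = ++-closed (sub a) (sub-closed a) (sub-closed b)
  below-closed (a ∙ b)  = ++-closed (sub a) (sub-closed a) (sub-closed b)
  below-closed (a ／ b)  = ++-closed (sub a) (sub-closed a) (sub-closed b)
  below-closed (a ∖∖ b) = ++-closed (sub a) (sub-closed a) (sub-closed b)
  below-closed (a ／／ b) = ++-closed (sub a) (sub-closed a) (sub-closed b)
  below-closed (a ∧ b)  = ++-closed (sub a) (sub-closed a) (sub-closed b)
  below-closed (a ∨ b)  = ++-closed (sub a) (sub-closed a) (sub-closed b)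
  below-closed (var _)  ()
  below-closed ⊤ᶠ       ()
  below-closed ⊥ᶠ       ()

-- A marking of cl decides, for each formula of cl, whether it is taken to hold.
Marking : List Fm → Set
Marking cl = Subset (length cl)

-- Whether φ is marked in τ (at its first occurrence in cl; false if φ ∉ cl).
member : ∀ cl → Marking cl → Fm → Bool
member []       []      φ = false
member (ψ ∷ cl) (b ∷ τ) φ with ψ ≟ φ
... | yes _ = b
... | no  _ = member cl τ φ

Inside : ∀ cl → (Fm → Set) → Marking cl → Set
Inside cl P τ = ∀ {φ} → T (member cl τ φ) → P φ

Outside : ∀ cl → (Fm → Set) → Marking cl → Set
Outside cl P τ = Σ Fm λ φ → φ ∈ˡ cl × ¬ T (member cl τ φ) × P φ

inside-∷ : ∀ {cl ψ b τ} {P : Fm → Set} → (T b → P ψ) → Inside cl P τ → Inside (ψ ∷ cl) P (b ∷ τ)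
inside-∷ {ψ = ψ} head rest {φ} m with ψ ≟ φ
... | yes refl = head m
... | no  _    = rest m

outside-∷ : ∀ {cl ψ b τ} {P : Fm → Set} → Outside (ψ ∷ cl) P (b ∷ τ) → (¬ T b × P ψ) ⊎ Outside cl P τ
outside-∷ {ψ = ψ} (.ψ , here refl , ¬m , pψ) with ψ ≟ ψ
... | yes _  = inj₁ (¬m , pψ)
... | no ψ≢ψ = ⊥-elim (ψ≢ψ refl)
outside-∷ {ψ = ψ} (φ , there φ∈ , ¬m , pφ) with ψ ≟ φ
... | yes refl = inj₁ (¬m , pφ)
... | no  _    = inj₂ (φ , φ∈ , ¬m , pφ)

-- Constructive form of "every state realises some marking": to establish G it
-- suffices to derive, for each marking τ whose marked formulas all hold, either G
-- or the truth of some unmarked formula. By induction on cl: first mark the head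
-- formula false; should that only show that the head formula holds, mark it true.
cut : ∀ cl (P : Fm → Set) {G : Set} → (∀ τ → Inside cl P τ → G ⊎ Outside cl P τ) → G
cut [] P h with h [] (λ ())
... | inj₁ g = g
... | inj₂ (_ , () , _)
cut (ψ ∷ cl) P {G} h with cut cl P {G ⊎ P ψ} unmarked
  where
  unmarked : ∀ τ → Inside cl P τ → (G ⊎ P ψ) ⊎ Outside cl P τ
  unmarked τ γ with h (false ∷ τ) (inside-∷ {cl} {ψ} {false} {τ} (λ ()) γ)
  ... | inj₁ g = inj₁ (inj₁ g)
  ... | inj₂ δ with outside-∷ {cl} {ψ} {_} {τ} δ
  ...   | inj₁ (_ , pψ) = inj₁ (inj₂ pψ)
  ...   | inj₂ δ′       = inj₂ δ′
... | inj₁ g  = g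
... | inj₂ pψ = cut cl P marked
  where
  marked : ∀ τ → Inside cl P τ → G ⊎ Outside cl P τ
  marked τ γ with h (true ∷ τ) (inside-∷ {cl} {ψ} {true} {τ} (λ _ → pψ) γ)
  ... | inj₁ g = inj₁ g
  ... | inj₂ δ with outside-∷ {cl} {ψ} {_} {τ} δ
  ...   | inj₁ (¬true , _) = ⊥-elim (¬true _)
  ...   | inj₂ δ′          = inj₂ δ′

markings : ∀ n → List (Subset n)
markings zero    = [] ∷ []
markings (suc n) = map (true ∷_) (markings n) ++ map (false ∷_) (markings n)

markings-complete : ∀ {n} (τ : Subset n) → τ ∈ˡ markings n
markings-complete []          = here refl
markings-complete (true ∷ τ)  = ∈-++⁺ˡ (∈-map⁺ (true ∷_) (markings-complete τ))
markings-complete (false ∷ τ) =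
  ∈-++⁺ʳ (map (true ∷_) (markings _)) (∈-map⁺ (false ∷_) (markings-complete τ))

-- ∖ and ∖∖ read the ternary relation backwards (R x s y), ／ and ／／ forwards (R s x y);
-- a direction lets both be treated at once.
data Dir : Set where
  back fwd : Dir

res iter : Dir → Fm → Fm → Fm
res back X Y  = X ∖ Y
res fwd  X Y  = Y ／ X
iter back X Y = X ∖∖ Y
iter fwd  X Y = Y ／／ X

module Directed (M : Model) where
  open Model M using (S; R)

  Edge : Dir → S → S → S → Set
  Edge back x s y = R x s y
  Edge fwd  x s y = R s x y

  Path : Dir → S → List S → S → S → Set
  Path back = RBack M
  Path fwd  = RFwd M

  path-[] : ∀ d {x s t} → Path d x [] s t ⇔ Edge d x s t
  path-[] back = mk⇔ id id
  path-[] fwd  = mk⇔ id id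

  path-∷ : ∀ d {x x′ xs s t} → Path d x (x′ ∷ xs) s t ⇔ (Σ S λ y → Edge d x s y × Path d x′ xs y t)
  path-∷ back = mk⇔ id id
  path-∷ fwd  = mk⇔ id id

  sat-res : ∀ d {X Y s} → Sat M (res d X Y) s ⇔ (∀ t u → Edge d t s u → Sat M X t → Sat M Y u)
  sat-res back = mk⇔ id id
  sat-res fwd  = mk⇔ id id

  sat-iter : ∀ d {X Y s} →
    Sat M (iter d X Y) s ⇔ (∀ t x xs → All (Sat M X) (x ∷ xs) → Path d x xs s t → Sat M Y t)
  sat-iter back = mk⇔ id id
  sat-iter fwd  = mk⇔ id id

-- Throughout, cl is a closed list of formulas; a type is a marking of cl, indexed
-- by Fin so that sets of types are subsets of a finite set.
module Closure (cl : List Fm) (closed : Closed cl) where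

  typeList : List (Marking cl)
  typeList = markings (length cl)

  Ty : Set
  Ty = Fin (length typeList)

  TypeSet : Set
  TypeSet = Subset (length typeList)

  ⟦_⟧ : Ty → Marking cl
  ⟦ i ⟧ = lookup typeList i

  Has : Ty → Fm → Set
  Has τ φ = T (member cl ⟦ τ ⟧ φ)

  has? : ∀ τ φ → Dec (Has τ φ)
  has? τ φ = T? (member cl ⟦ τ ⟧ φ)

  res-args : ∀ d {X Y} → res d X Y ∈ˡ cl → X ∈ˡ cl × Y ∈ˡ cl
  res-args back p = closed p (here refl) , closed p (there (here refl))
  res-args fwd  p = closed p (there (here refl)) , closed p (here refl)

  iter-args : ∀ d {X Y} → iter d X Y ∈ˡ cl → X ∈ˡ cl × Y ∈ˡ cl
  iter-args back p = closed p (here refl) , closed p (there (here refl))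
  iter-args fwd  p = closed p (there (here refl)) , closed p (here refl)

  CompatAt : Fm → Ty → Ty → Ty → Set
  CompatAt (X ∖ Y)  a b c = Has b (X ∖ Y) → Has a X → Has c Y
  CompatAt (Y ／ X)  a b c = Has a (Y ／ X) → Has b X → Has c Y
  CompatAt (X ∙ Y)  a b c = Has a X → Has b Y → Has c (X ∙ Y)
  CompatAt (X ∖∖ Y) a b c = Has b (X ∖∖ Y) → Has a X → Has c Y × Has c (X ∖∖ Y)
  CompatAt (Y ／／ X) a b c = Has a (Y ／／ X) → Has b X → Has c Y × Has c (Y ／／ X)
  CompatAt _        a b c = ⊤

  compatAt? : ∀ ψ a b c → Dec (CompatAt ψ a b c)
  compatAt? (X ∖ Y)  a b c = has? b _ →-dec has? a X →-dec has? c Y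
  compatAt? (Y ／ X)  a b c = has? a _ →-dec has? b X →-dec has? c Y
  compatAt? (X ∙ Y)  a b c = has? a X →-dec has? b Y →-dec has? c _
  compatAt? (X ∖∖ Y) a b c = has? b _ →-dec has? a X →-dec has? c Y ×-dec has? c _
  compatAt? (Y ／／ X) a b c = has? a _ →-dec has? b X →-dec has? c Y ×-dec has? c _
  compatAt? (var _)  a b c = yes tt
  compatAt? ⊤ᶠ       a b c = yes tt
  compatAt? ⊥ᶠ       a b c = yes tt
  compatAt? (_ ∧ _)  a b c = yes tt
  compatAt? (_ ∨ _)  a b c = yes tt

  Compat : Ty → Ty → Ty → Set
  Compat a b c = All (λ ψ → CompatAt ψ a b c) cl

  compat? : ∀ a b c → Dec (Compat a b c)
  compat? a b c = all? (λ ψ → compatAt? ψ a b c) cl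

  Link : Dir → Ty → Ty → Ty → Set
  Link back x σ y = Compat x σ y
  Link fwd  x σ y = Compat σ x y

  link? : ∀ d x σ y → Dec (Link d x σ y)
  link? back x σ y = compat? x σ y
  link? fwd  x σ y = compat? σ x y

  link-res : ∀ d {X Y x σ y} → res d X Y ∈ˡ cl → Link d x σ y →
             Has σ (res d X Y) → Has x X → Has y Y
  link-res back p c = All.lookup c p
  link-res fwd  p c = All.lookup c p

  link-iter : ∀ d {X Y x σ y} → iter d X Y ∈ˡ cl → Link d x σ y →
              Has σ (iter d X Y) → Has x X → Has y Y × Has y (iter d X Y)
  link-iter back p c = All.lookup c p
  link-iter fwd  p c = All.lookup c p

  Counter : TypeSet → Dir → Fm → Fm → Ty → Set
  Counter A d X Y σ = Σ Ty λ x → Σ Ty λ y → x ∈ A × y ∈ A × Link d x σ y × Has x X × ¬ Has y Y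

  counter? : ∀ A d X Y σ → Dec (Counter A d X Y σ)
  counter? A d X Y σ = any? λ x → any? λ y →
    (x ∈? A) ×-dec (y ∈? A) ×-dec link? d x σ y ×-dec has? x X ×-dec ¬? (has? y Y)

  Factor : TypeSet → Fm → Fm → Ty → Set
  Factor A X Y τ = Σ Ty λ x → Σ Ty λ y → x ∈ A × y ∈ A × Compat x y τ × Has x X × Has y Y

  factor? : ∀ A X Y τ → Dec (Factor A X Y τ)
  factor? A X Y τ = any? λ x → any? λ y →
    (x ∈? A) ×-dec (y ∈? A) ×-dec compat? x y τ ×-dec has? x X ×-dec has? y Y

  -- The types from which an X-path through A along d reaches a type outside Y:
  -- the least E closed under EscapeStep A d X Y E.
  EscapeStep : TypeSet → Dir → Fm → Fm → TypeSet → Ty → Set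
  EscapeStep A d X Y E σ =
    Σ Ty λ x → Σ Ty λ y → x ∈ A × y ∈ A × Link d x σ y × Has x X × (¬ Has y Y ⊎ y ∈ E)

  escapeStep? : ∀ A d X Y E σ → Dec (EscapeStep A d X Y E σ)
  escapeStep? A d X Y E σ = any? λ x → any? λ y →
    (x ∈? A) ×-dec (y ∈? A) ×-dec link? d x σ y ×-dec has? x X ×-dec (¬? (has? y Y) ⊎-dec (y ∈? E))

  module Escaping (A : TypeSet) (d : Dir) (X Y : Fm) =
    Saturation (λ E → E ∪ select (escapeStep? A d X Y E)) (λ E → p⊆p∪q _)

  -- Opaque so that type checking never unfolds the iteration; only its closure
  -- property and its description by stages are used.
  opaque
    Escape : TypeSet → Dir → Fm → Fm → TypeSet
    Escape A d X Y = Escaping.limit A d X Y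

  opaque
    unfolding Escape

    escape-closed : ∀ {A d X Y σ} → EscapeStep A d X Y (Escape A d X Y) σ → σ ∈ Escape A d X Y
    escape-closed {A} {d} {X} {Y} {σ} st =
      subst (σ ∈_) (Escaping.limit-fixed A d X Y)
        (x∈p∪q⁺ (inj₂ (select-complete (escapeStep? A d X Y _) st)))

    escape-stage : ∀ {A d X Y σ} → σ ∈ Escape A d X Y → Σ ℕ λ j → σ ∈ Escaping.stage A d X Y j
    escape-stage σ∈ = suc (length typeList) , σ∈

  ConjOk DisjOk : Ty → Fm → Fm → Set
  ConjOk τ X Y = (Has τ (X ∧ Y) → Has τ X × Has τ Y) × (Has τ X × Has τ Y → Has τ (X ∧ Y))
  DisjOk τ X Y = (Has τ (X ∨ Y) → Has τ X ⊎ Has τ Y) × (Has τ X ⊎ Has τ Y → Has τ (X ∨ Y))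

  Demand : TypeSet → Ty → Fm → Set
  Demand A τ (var _)  = ⊤
  Demand A τ ⊤ᶠ       = Has τ ⊤ᶠ
  Demand A τ ⊥ᶠ       = ¬ Has τ ⊥ᶠ
  Demand A τ (X ∧ Y)  = ConjOk τ X Y
  Demand A τ (X ∨ Y)  = DisjOk τ X Y
  Demand A τ (X ∙ Y)  = Has τ (X ∙ Y) → Factor A X Y τ
  Demand A τ (X ∖ Y)  = Has τ (X ∖ Y) ⊎ Counter A back X Y τ
  Demand A τ (Y ／ X)  = Has τ (Y ／ X) ⊎ Counter A fwd X Y τ
  Demand A τ (X ∖∖ Y) = Has τ (X ∖∖ Y) ⊎ τ ∈ Escape A back X Y
  Demand A τ (Y ／／ X) = Has τ (Y ／／ X) ⊎ τ ∈ Escape A fwd X Y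

  demand? : ∀ A τ ψ → Dec (Demand A τ ψ)
  demand? A τ (var _)  = yes tt
  demand? A τ ⊤ᶠ       = has? τ ⊤ᶠ
  demand? A τ ⊥ᶠ       = ¬? (has? τ ⊥ᶠ)
  demand? A τ (X ∧ Y)  =
    (has? τ _ →-dec (has? τ X ×-dec has? τ Y)) ×-dec ((has? τ X ×-dec has? τ Y) →-dec has? τ _)
  demand? A τ (X ∨ Y)  =
    (has? τ _ →-dec (has? τ X ⊎-dec has? τ Y)) ×-dec ((has? τ X ⊎-dec has? τ Y) →-dec has? τ _)
  demand? A τ (X ∙ Y)  = has? τ _ →-dec factor? A X Y τ
  demand? A τ (X ∖ Y)  = has? τ _ ⊎-dec counter? A back X Y τ
  demand? A τ (Y ／ X)  = has? τ _ ⊎-dec counter? A fwd X Y τ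
  demand? A τ (X ∖∖ Y) = has? τ _ ⊎-dec (τ ∈? Escape A back X Y)
  demand? A τ (Y ／／ X) = has? τ _ ⊎-dec (τ ∈? Escape A fwd X Y)

  demand-res : ∀ d {A τ X Y} → Demand A τ (res d X Y) → Has τ (res d X Y) ⊎ Counter A d X Y τ
  demand-res back = id
  demand-res fwd  = id

  demand-iter : ∀ d {A τ X Y} → Demand A τ (iter d X Y) → Has τ (iter d X Y) ⊎ τ ∈ Escape A d X Y
  demand-iter back = id
  demand-iter fwd  = id

  Ok : TypeSet → Ty → Set
  Ok A τ = All (Demand A τ) cl

  ok? : ∀ A τ → Dec (Ok A τ)
  ok? A τ = all? (demand? A τ) cl

  eliminate : TypeSet → TypeSet
  eliminate E = E ∪ select (λ τ → ¬? (ok? (∁ E) τ))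

  module Elimination = Saturation eliminate (λ E → p⊆p∪q _)

  -- The surviving types; opaque for the same reason as Escape.
  opaque
    Alive : TypeSet
    Alive = ∁ Elimination.limit

  opaque
    unfolding Alive

    alive-ok : ∀ {τ} → τ ∈ Alive → Ok Alive τ
    alive-ok {τ} alive = decidable-stable (ok? Alive τ) λ ¬ok →
      x∈∁p⇒x∉p alive (subst (τ ∈_) Elimination.limit-fixed
        (x∈p∪q⁺ (inj₂ (select-complete (λ σ → ¬? (ok? Alive σ)) ¬ok))))

    alive-or-discarded : ∀ τ → τ ∈ Alive ⊎ τ ∈ Elimination.limit
    alive-or-discarded τ with τ ∈? Elimination.limit
    ... | yes discarded = inj₂ discarded
    ... | no  survives  = inj₁ (x∉p⇒x∈∁p survives)

  module Soundness (M : Model) where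
    open Model M using (S; R)
    open Directed M
    open Equivalence

    Γ Δ : Ty → S → Set
    Γ τ z = Inside cl (λ φ → Sat M φ z) ⟦ τ ⟧
    Δ τ z = Outside cl (λ φ → Sat M φ z) ⟦ τ ⟧

    Refuted : Ty → S → Set
    Refuted τ z = Γ τ z → Δ τ z

    out : ∀ {φ τ z} → φ ∈ˡ cl → ¬ Has τ φ → Sat M φ z → Δ τ z
    out p ¬h s = _ , p , ¬h , s

    cut-types : ∀ z {G : Set} → (∀ τ → Γ τ z → G ⊎ Δ τ z) → G
    cut-types z {G} h = cut cl P λ τ γ →
      let τ≡ = lookup-index (markings-complete τ)
      in subst (λ τ → G ⊎ Outside cl P τ) (sym τ≡) (h _ (subst (Inside cl P) τ≡ γ))
      where
      P : Fm → Set
      P φ = Sat M φ z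

    incompatible : ∀ {a b c ta tb tc} → R a b c → Γ ta a → Γ tb b → Γ tc c →
                   ¬ Compat ta tb tc → Δ tc c
    incompatible {a} {b} {c} {ta} {tb} {tc} r γa γb γc ¬compat
      with find (¬All⇒Any¬ (λ ψ → compatAt? ψ ta tb tc) cl ¬compat)
    ... | ψ , p , ¬c = clash ψ p ¬c
      where
      clash : ∀ ψ → ψ ∈ˡ cl → ¬ CompatAt ψ ta tb tc → Δ tc c
      clash (X ∖ Y) p ¬c with refute→ (has? tb _) ¬c
      ... | h , ¬c′ with refute→ (has? ta X) ¬c′
      ...   | hx , ¬hy = out (closed p (there (here refl))) ¬hy (γb h a c r (γa hx))
      clash (Y ／ X) p ¬c with refute→ (has? ta _) ¬c
      ... | h , ¬c′ with refute→ (has? tb X) ¬c′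
      ...   | hx , ¬hy = out (closed p (here refl)) ¬hy (γa h b c r (γb hx))
      clash (X ∙ Y) p ¬c with refute→ (has? ta X) ¬c
      ... | hx , ¬c′ with refute→ (has? tb Y) ¬c′
      ...   | hy , ¬h = out p ¬h (a , b , r , γa hx , γb hy)
      clash (X ∖∖ Y) p ¬c with refute→ (has? tb _) ¬c
      ... | h , ¬c′ with refute→ (has? ta X) ¬c′ | has? tc Y
      ...   | hx , ¬both | no ¬hy = out (closed p (there (here refl))) ¬hy (γb h c a [] (γa hx ∷ []) r)
      ...   | hx , ¬both | yes hy = out p (λ h′ → ¬both (hy , h′))
                                (λ t x xs sxs path → γb h t a (x ∷ xs) (γa hx ∷ sxs) (c , r , path))
      clash (Y ／／ X) p ¬c with refute→ (has? ta _) ¬c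
      ... | h , ¬c′ with refute→ (has? tb X) ¬c′ | has? tc Y
      ...   | hx , ¬both | no ¬hy = out (closed p (here refl)) ¬hy (γa h c b [] (γb hx ∷ []) r)
      ...   | hx , ¬both | yes hy = out p (λ h′ → ¬both (hy , h′))
                                (λ t x xs sxs path → γa h t b (x ∷ xs) (γb hx ∷ sxs) (c , r , path))
      clash (var _) p ¬c = ⊥-elim (¬c tt)
      clash ⊤ᶠ      p ¬c = ⊥-elim (¬c tt)
      clash ⊥ᶠ      p ¬c = ⊥-elim (¬c tt)
      clash (_ ∧ _) p ¬c = ⊥-elim (¬c tt)
      clash (_ ∨ _) p ¬c = ⊥-elim (¬c tt)

    link-refutes : ∀ d {x s y tx ts ty} → Edge d x s y → Γ tx x → Γ ts s → Γ ty y →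
                   ¬ Link d tx ts ty → Δ ty y
    link-refutes back e γx γs γy = incompatible e γx γs γy
    link-refutes fwd  e γx γs γy = incompatible e γs γx γy

    conj-fails : ∀ {X Y τ z} → (X ∧ Y) ∈ˡ cl → ¬ ConjOk τ X Y → Refuted τ z
    conj-fails {X} {Y} {τ} p fail γ with has? τ (X ∧ Y) | has? τ X | has? τ Y
    ... | yes h  | yes hx | yes hy = ⊥-elim (fail ((λ _ → hx , hy) , λ _ → h))
    ... | yes h  | no ¬hx | _      = out (closed p (here refl)) ¬hx (proj₁ (γ h))
    ... | yes h  | yes _  | no ¬hy = out (closed p (there (here refl))) ¬hy (proj₂ (γ h))
    ... | no ¬h  | yes hx | yes hy = out p ¬h (γ hx , γ hy)
    ... | no ¬h  | no ¬hx | _      = ⊥-elim (fail ((⊥-elim ∘ ¬h) , ⊥-elim ∘ ¬hx ∘ proj₁))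
    ... | no ¬h  | yes _  | no ¬hy = ⊥-elim (fail ((⊥-elim ∘ ¬h) , ⊥-elim ∘ ¬hy ∘ proj₂))

    disj-fails : ∀ {X Y τ z} → (X ∨ Y) ∈ˡ cl → ¬ DisjOk τ X Y → Refuted τ z
    disj-fails {X} {Y} {τ} p fail γ with has? τ (X ∨ Y) | has? τ X | has? τ Y
    ... | yes h  | yes hx | _      = ⊥-elim (fail ((λ _ → inj₁ hx) , λ _ → h))
    ... | yes h  | no _   | yes hy = ⊥-elim (fail ((λ _ → inj₂ hy) , λ _ → h))
    ... | yes h  | no ¬hx | no ¬hy =
      [ out (closed p (here refl)) ¬hx , out (closed p (there (here refl))) ¬hy ]′ (γ h)
    ... | no ¬h  | yes hx | _      = out p ¬h (inj₁ (γ hx))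
    ... | no ¬h  | no _   | yes hy = out p ¬h (inj₂ (γ hy))
    ... | no ¬h  | no ¬hx | no ¬hy = ⊥-elim (fail ((⊥-elim ∘ ¬h) , [ ⊥-elim ∘ ¬hx , ⊥-elim ∘ ¬hy ]′))

    -- One round of elimination is sound: if every type in E is refuted everywhere,
    -- so is every type that fails a demand relative to the survivors ∁ E.
    module Round (E : TypeSet) (E-refuted : ∀ {σ} → σ ∈ E → ∀ z → Refuted σ z) where

      cut-alive : ∀ z {G : Set} → (∀ τ → τ ∈ ∁ E → Γ τ z → G ⊎ Δ τ z) → G
      cut-alive z h = cut-types z λ τ γ → case τ ∈? E of λ where
        (yes τ∈E) → inj₂ (E-refuted τ∈E z γ)
        (no τ∉E)  → h τ (x∉p⇒x∈∁p τ∉E) γ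

      cut-alive₂ : ∀ x y {G : Set} →
        (∀ tx ty → tx ∈ ∁ E → ty ∈ ∁ E → Γ tx x → Γ ty y → G ⊎ Δ tx x ⊎ Δ ty y) → G
      cut-alive₂ x y h = cut-alive x λ tx ax γx → cut-alive y λ ty ay γy → assocˡ (h tx ty ax ay γx γy)

      residual-sat : ∀ d {X Y τ z} → res d X Y ∈ˡ cl → ¬ Counter (∁ E) d X Y τ → Γ τ z →
                     Sat M (res d X Y) z
      residual-sat d {X} {Y} {τ} {z} p none γ = from (sat-res d) λ t u e sx →
        cut-alive₂ t u λ tx tu ax au γx γu → step e sx tx tu ax au γx γu
        where
        step : ∀ {t u} → Edge d t z u → Sat M X t → ∀ tx tu → tx ∈ ∁ E → tu ∈ ∁ E → Γ tx t → Γ tu u →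
               Sat M Y u ⊎ Δ tx t ⊎ Δ tu u
        step e sx tx tu ax au γx γu with has? tx X | has? tu Y | link? d tx τ tu
        ... | no ¬hx | _      | _      = inj₂ (inj₁ (out (proj₁ (res-args d p)) ¬hx sx))
        ... | yes _  | yes hy | _      = inj₁ (γu hy)
        ... | yes hx | no ¬hy | yes l  = ⊥-elim (none (tx , tu , ax , au , l , hx , ¬hy))
        ... | yes _  | no _   | no ¬l  = inj₂ (inj₂ (link-refutes d e γx γ γu ¬l))

      product-refutes : ∀ {X Y τ z} → X ∙ Y ∈ˡ cl → ¬ Factor (∁ E) X Y τ → Γ τ z →
                        Sat M (X ∙ Y) z → Δ τ z
      product-refutes {X} {Y} {τ} p none γ (t , u , r , sx , sy) =
        cut-alive₂ t u λ tx tu ax au γx γu → step tx tu ax au γx γu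
        where
        step : ∀ tx tu → tx ∈ ∁ E → tu ∈ ∁ E → Γ tx t → Γ tu u → _ ⊎ Δ tx t ⊎ Δ tu u
        step tx tu ax au γx γu with has? tx X | has? tu Y | compat? tx tu τ
        ... | no ¬hx | _      | _      = inj₂ (inj₁ (out (closed p (here refl)) ¬hx sx))
        ... | yes _  | no ¬hy | _      = inj₂ (inj₂ (out (closed p (there (here refl))) ¬hy sy))
        ... | yes hx | yes hy | yes c  = ⊥-elim (none (tx , tu , ax , au , c , hx , hy))
        ... | yes _  | yes _  | no ¬c  = inj₁ (incompatible r γx γu γ ¬c)

      path-sat : ∀ d {X Y} → X ∈ˡ cl → ∀ xs {x w t σ} → σ ∉ Escape (∁ E) d X Y → Γ σ w →
                 All (Sat M X) (x ∷ xs) → Path d x xs w t → Sat M Y t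
      path-sat d {X} {Y} pX [] {x} {w} {t} {σ} σ∉ γ (sx ∷ []) path =
        cut-alive₂ x t λ tx tu ax au γx γu → step tx tu ax au γx γu
        where
        step : ∀ tx tu → tx ∈ ∁ E → tu ∈ ∁ E → Γ tx x → Γ tu t → Sat M Y t ⊎ Δ tx x ⊎ Δ tu t
        step tx tu ax au γx γu with has? tx X | has? tu Y | link? d tx σ tu
        ... | no ¬hx | _      | _      = inj₂ (inj₁ (out pX ¬hx sx))
        ... | yes _  | yes hy | _      = inj₁ (γu hy)
        ... | yes hx | no ¬hy | yes l  = ⊥-elim (σ∉ (escape-closed (tx , tu , ax , au , l , hx , inj₁ ¬hy)))
        ... | yes _  | no _   | no ¬l  = inj₂ (inj₂ (link-refutes d (to (path-[] d) path) γx γ γu ¬l))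
      path-sat d {X} {Y} pX (x′ ∷ xs) {x} {w} {t} {σ} σ∉ γ (sx ∷ sxs) path
        with to (path-∷ d) path
      ... | y , e , rest = cut-alive₂ x y λ tx ty ax ay γx γy → step tx ty ax ay γx γy
        where
        step : ∀ tx ty → tx ∈ ∁ E → ty ∈ ∁ E → Γ tx x → Γ ty y → Sat M Y t ⊎ Δ tx x ⊎ Δ ty y
        step tx ty ax ay γx γy with has? tx X | link? d tx σ ty | ty ∈? Escape (∁ E) d X Y
        ... | no ¬hx | _     | _       = inj₂ (inj₁ (out pX ¬hx sx))
        ... | yes hx | yes l | yes y∈  = ⊥-elim (σ∉ (escape-closed (tx , ty , ax , ay , l , hx , inj₂ y∈)))
        ... | yes _  | yes _ | no y∉   = inj₁ (path-sat d pX xs y∉ γy sxs rest)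
        ... | yes _  | no ¬l | _       = inj₂ (inj₂ (link-refutes d e γx γ γy ¬l))

      iter-sat : ∀ d {X Y τ z} → iter d X Y ∈ˡ cl → τ ∉ Escape (∁ E) d X Y → Γ τ z →
                 Sat M (iter d X Y) z
      iter-sat d p τ∉ γ = from (sat-iter d) λ t x xs sxs path →
        path-sat d (proj₁ (iter-args d p)) xs τ∉ γ sxs path

      demand-fails : ∀ ψ {τ} z → ψ ∈ˡ cl → ¬ Demand (∁ E) τ ψ → Refuted τ z
      demand-fails (var _) z p fail γ = ⊥-elim (fail tt)
      demand-fails ⊤ᶠ      z p fail γ = out p fail tt
      demand-fails ⊥ᶠ      z p fail γ = ⊥-elim (fail γ)
      demand-fails (X ∧ Y) z p fail γ = conj-fails p fail γ
      demand-fails (X ∨ Y) z p fail γ = disj-fails p fail γ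
      demand-fails (X ∙ Y) {τ} z p fail γ with has? τ (X ∙ Y)
      ... | yes h = product-refutes p (fail ∘ const) γ (γ h)
      ... | no ¬h = ⊥-elim (fail (⊥-elim ∘ ¬h))
      demand-fails (X ∖ Y)  z p fail γ = out p (fail ∘ inj₁) (residual-sat back p (fail ∘ inj₂) γ)
      demand-fails (Y ／ X)  z p fail γ = out p (fail ∘ inj₁) (residual-sat fwd p (fail ∘ inj₂) γ)
      demand-fails (X ∖∖ Y) z p fail γ = out p (fail ∘ inj₁) (iter-sat back p (fail ∘ inj₂) γ)
      demand-fails (Y ／／ X) z p fail γ = out p (fail ∘ inj₁) (iter-sat fwd p (fail ∘ inj₂) γ)

    discarded-refuted : ∀ j {τ} → τ ∈ Elimination.stage j → ∀ z → Refuted τ z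
    discarded-refuted zero τ∈ = ⊥-elim (∉⊥ τ∈)
    discarded-refuted (suc j) {τ} τ∈ z with x∈p∪q⁻ _ _ τ∈
    ... | inj₁ old = discarded-refuted j old z
    ... | inj₂ new with find (¬All⇒Any¬ (demand? _ τ) cl (select-sound (λ σ → ¬? (ok? _ σ)) new))
    ...   | ψ , p , fail = Round.demand-fails (Elimination.stage j) (discarded-refuted j) ψ z p fail

  module Canonical (τ₀ : Ty) (alive₀ : τ₀ ∈ Alive) where
    open Equivalence

    State : Set
    State = Σ Ty (_∈ Alive)

    model : Model
    model = record
      { frame = record
          { S = State ; inh = τ₀ , alive₀ ; R = λ a b c → Compat (proj₁ a) (proj₁ b) (proj₁ c) }
      ; V     = λ p s → Has (proj₁ s) (var p)
      }

    open Directed model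

    edge-link : ∀ d {x s y} → Edge d x s y ⇔ Link d (proj₁ x) (proj₁ s) (proj₁ y)
    edge-link back = mk⇔ id id
    edge-link fwd  = mk⇔ id id

    demand : ∀ {ψ} (s : State) → ψ ∈ˡ cl → Demand Alive (proj₁ s) ψ
    demand (τ , alive) p = All.lookup (alive-ok alive) p

    Truth : Fm → Set
    Truth φ = ∀ s → Sat model φ s ⇔ Has (proj₁ s) φ

    truth-res : ∀ d {X Y} → res d X Y ∈ˡ cl → Truth X → Truth Y → Truth (res d X Y)
    truth-res d {X} {Y} p tX tY s = mk⇔ sat⇒has has⇒sat
      where
      has⇒sat : Has (proj₁ s) (res d X Y) → Sat model (res d X Y) s
      has⇒sat h = from (sat-res d) λ t u e sx →
        from (tY u) (link-res d p (to (edge-link d) e) h (to (tX t) sx))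

      sat⇒has : Sat model (res d X Y) s → Has (proj₁ s) (res d X Y)
      sat⇒has sat with demand-res d (demand s p)
      ... | inj₁ h = h
      ... | inj₂ (x , y , ax , ay , l , hx , ¬hy) =
        ⊥-elim (¬hy (to (tY (y , ay))
          (to (sat-res d) sat (x , ax) (y , ay) (from (edge-link d) l) (from (tX (x , ax)) hx))))

    truth-iter : ∀ d {X Y} → iter d X Y ∈ˡ cl → Truth X → Truth Y → Truth (iter d X Y)
    truth-iter d {X} {Y} p tX tY s =
      mk⇔ sat⇒has (λ h → from (sat-iter d) λ t x xs sxs path → propagate xs sxs path h)
      where
      -- Along an X-path, the formula iter d X Y is passed on and Y is delivered at the end.
      propagate : ∀ xs {x s t} → All (Sat model X) (x ∷ xs) → Path d x xs s t →
                  Has (proj₁ s) (iter d X Y) → Sat model Y t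
      propagate [] {t = t} (sx ∷ []) path h =
        from (tY t) (proj₁ (link-iter d p (to (edge-link d) (to (path-[] d) path)) h (to (tX _) sx)))
      propagate (x′ ∷ xs) (sx ∷ sxs) path h with to (path-∷ d) path
      ... | y , e , rest =
        propagate xs sxs rest (proj₂ (link-iter d p (to (edge-link d) e) h (to (tX _) sx)))

      escape-path : ∀ j (s : State) → proj₁ s ∈ Escaping.stage Alive d X Y j →
        Σ State λ u → Σ State λ x → Σ (List State) λ xs →
          All (Sat model X) (x ∷ xs) × Path d x xs s u × ¬ Sat model Y u
      escape-path zero s s∈ = ⊥-elim (∉⊥ s∈)
      escape-path (suc j) s s∈ with x∈p∪q⁻ _ _ s∈
      ... | inj₁ old = escape-path j s old
      ... | inj₂ new with select-sound (escapeStep? Alive d X Y _) new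
      ...   | x , y , ax , ay , l , hx , inj₁ ¬hy =
        (y , ay) , (x , ax) , [] , from (tX _) hx ∷ [] , from (path-[] d) (from (edge-link d) l) ,
        ¬hy ∘ to (tY _)
      ...   | x , y , ax , ay , l , hx , inj₂ y∈ with escape-path j (y , ay) y∈
      ...     | u , x′ , xs , sxs , path , ¬su =
        u , (x , ax) , x′ ∷ xs , from (tX _) hx ∷ sxs ,
        from (path-∷ d) ((y , ay) , from (edge-link d) l , path) , ¬su

      sat⇒has : Sat model (iter d X Y) s → Has (proj₁ s) (iter d X Y)
      sat⇒has sat with demand-iter d (demand s p)
      ... | inj₁ h  = h
      ... | inj₂ s∈ with escape-stage s∈
      ...   | j , s∈ⱼ with escape-path j s s∈ⱼ
      ...     | u , x , xs , sxs , path , ¬su = ⊥-elim (¬su (to (sat-iter d) sat u x xs sxs path))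

    truth : ∀ φ → φ ∈ˡ cl → Truth φ
    truth (var _)  p s = mk⇔ id id
    truth ⊤ᶠ       p s = mk⇔ (λ _ → demand s p) (λ _ → tt)
    truth ⊥ᶠ       p s = mk⇔ (λ ()) (λ h → ⊥-elim (demand s p h))
    truth (X ∧ Y)  p s with demand s p
    ... | split , join = mk⇔ (λ (sx , sy) → join (to (tX s) sx , to (tY s) sy))
                             (λ h → Product.map (from (tX s)) (from (tY s)) (split h))
      where
      tX : Truth X
      tX = truth X (closed p (here refl))
      tY : Truth Y
      tY = truth Y (closed p (there (here refl)))
    truth (X ∨ Y)  p s with demand s p
    ... | split , join = mk⇔ (join ∘ Sum.map (to (tX s)) (to (tY s)))
                             (Sum.map (from (tX s)) (from (tY s)) ∘ split)
      where
      tX : Truth X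
      tX = truth X (closed p (here refl))
      tY : Truth Y
      tY = truth Y (closed p (there (here refl)))
    truth (X ∙ Y)  p s = mk⇔ sat⇒has has⇒sat
      where
      tX : Truth X
      tX = truth X (closed p (here refl))
      tY : Truth Y
      tY = truth Y (closed p (there (here refl)))
      sat⇒has : Sat model (X ∙ Y) s → Has (proj₁ s) (X ∙ Y)
      sat⇒has (t , u , c , sx , sy) = All.lookup c p (to (tX t) sx) (to (tY u) sy)
      has⇒sat : Has (proj₁ s) (X ∙ Y) → Sat model (X ∙ Y) s
      has⇒sat h with demand s p h
      ... | x , y , ax , ay , c , hx , hy = (x , ax) , (y , ay) , c , from (tX _) hx , from (tY _) hy
    truth (X ∖ Y)  p = truth-res back p (truth X (proj₁ (res-args back p))) (truth Y (proj₂ (res-args back p)))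
    truth (Y ／ X)  p = truth-res fwd p (truth X (proj₁ (res-args fwd p))) (truth Y (proj₂ (res-args fwd p)))
    truth (X ∖∖ Y) p = truth-iter back p (truth X (proj₁ (iter-args back p))) (truth Y (proj₂ (iter-args back p)))
    truth (Y ／／ X) p = truth-iter fwd p (truth X (proj₁ (iter-args fwd p))) (truth Y (proj₂ (iter-args fwd p)))

  countermodel : ∀ {A B τ} → A ∈ˡ cl → B ∈ˡ cl → τ ∈ Alive → Has τ A → ¬ Has τ B → ¬ Valid A B
  countermodel {A} {B} {τ} pA pB alive hA ¬hB valid =
    ¬hB (Equivalence.to (truth B pB s) (valid _ _ s (Equivalence.from (truth A pA s) hA)))
    where
    open Canonical τ alive
    s : State
    s = τ , alive

  -- If every surviving type containing A contains B, then A ⊢ B is valid: a state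
  -- satisfying A realises some type, which is either discarded (impossible) or survives.
  valid : ∀ {A B} → A ∈ˡ cl → B ∈ˡ cl → (∀ τ → τ ∈ Alive → Has τ A → Has τ B) → Valid A B
  valid {A} {B} pA pB A⇒B F V s sa = cut-types s realise
    where
    M : Model
    M = record { frame = F ; V = V }
    open Soundness M

    realise : ∀ τ → Γ τ s → Sat M B s ⊎ Δ τ s
    realise τ γ with has? τ A | alive-or-discarded τ
    ... | no ¬hA | _              = inj₂ (out pA ¬hA sa)
    ... | yes hA | inj₁ alive     = inj₁ (γ (A⇒B τ alive hA))
    ... | yes _  | inj₂ discarded = inj₂ (discarded-refuted (suc (length typeList)) discarded s γ)

  decide : ∀ {A B} → A ∈ˡ cl → B ∈ˡ cl → Dec (Valid A B)
  decide {A} {B} pA pB with any? (λ τ → (τ ∈? Alive) ×-dec has? τ A ×-dec ¬? (has? τ B))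
  ... | yes (τ , alive , hA , ¬hB) = no (countermodel pA pB alive hA ¬hB)
  ... | no none = yes (valid pA pB λ τ alive hA →
                    decidable-stable (has? τ B) λ ¬hB → none (τ , alive , hA , ¬hB))

theorem2 : (A B : Fm) → Dec (Valid A B)
theorem2 A B = Closure.decide (sub (A ∧ B)) (sub-closed (A ∧ B)) A∈ B∈
  where
  A∈ : A ∈ˡ sub (A ∧ B)
  A∈ = there (here refl)

  B∈ : B ∈ˡ sub (A ∧ B)
  B∈ = there (∈-++⁺ʳ (sub A) (here refl))
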